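{- Let $\mathsf{D}$ be an optiongraph. The minimum quotient $\mathsf{D}/{\bowtie}$ is the unique simple quotient of $\mathsf{D}$: for a congruence relation $\theta$ on $\mathsf{D}$, the quotient $\mathsf{D}/\theta$ is simple if and only if $\theta={\bowtie}$.
   Context: An optiongraph is a nonempty set $\mathsf{D}$ (of positions, possibly infinite) together with an option function $\mathrm{Opt}_{\mathsf{D}}:\mathsf{D}\to 2^{\mathsf{D}}$. For an equivalence relation $\theta$, write $[p]$ for the class of $p$ and $[S]:=\{[s]\mid s\in S\}$. An equivalence relation on an optiongraph is a congruence relation if $p\mathrel{\theta}q$ implies $[\mathrm{Opt}(p)]=[\mathrm{Opt}(q)]$. The union $\bowtie$ of all congruence relations on $\mathsf{D}$ is itself a congruence relation (the maximum one). For a congruence relation $\theta$, the quotient optiongraph $\mathsf{D}/\theta$ is the set of classes with option function $\mathrm{Opt}_{\mathsf{D}/\theta}([p]):=[\mathrm{Opt}_{\mathsf{D}}(p)]$; $\mathsf{D}/{\bowtie}$ is called the minimum quotient. An optiongraph is simple if its only congruence relation is the equality relation (equivalently its maximum congruence relation is trivial). -}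

module Defs where

open import Level using (0ℓ) renaming (suc to lsuc)
open import Data.Product using (Σ; Σ-syntax; ∃; _×_; _,_)
open import Relation.Unary using (Pred)
open import Relation.Binary.Core using (Rel; _⇒_)
open import Relation.Binary.Structures using (IsEquivalence)
open import Relation.Binary.PropositionalEquality using (_≡_)

-- An optiongraph: a nonempty set of positions with an option function
-- Opt : D → 2^D  (subsets are predicates; `Opt p x` means x ∈ Opt(p)).
record OptionGraph : Set₁ where
  field
    Pos   : Set
    Opt   : Pos → Pred Pos 0ℓ
    point : Pos        -- nonemptiness

-- [S] = [T] for the classes of an equivalence R:
-- every element of S is R-related to some element of T and vice versa.
SameClasses : {A : Set} → Rel A 0ℓ → Pred A 0ℓ → Pred A 0ℓ → Set
SameClasses R S T =
  (∀ x → S x → Σ[ y ∈ _ ] (T y × R x y)) ×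
  (∀ y → T y → Σ[ x ∈ _ ] (S x × R x y))

-- An optiongraph whose positions are the classes of an equivalence
-- relation _≈_ on a carrier (used to represent quotients, since Agda has
-- no quotient types).  Opt p denotes the set of classes {[x] | Opt p x}.
record SetoidOptionGraph : Set₁ where
  field
    Carrier  : Set
    _≈_      : Rel Carrier 0ℓ
    isEquiv  : IsEquivalence _≈_
    Opt      : Carrier → Pred Carrier 0ℓ
    Opt-resp : ∀ {p q} → p ≈ q → SameClasses _≈_ (Opt p) (Opt q)
    point    : Carrier

-- Congruence relation on a (setoid) optiongraph: an equivalence relation
-- on the classes (i.e. an equivalence ψ on the carrier containing _≈_)
-- such that p ψ q implies [Opt(p)] = [Opt(q)] (classes modulo ψ).
record IsCongruence (G : SetoidOptionGraph) (ψ : Rel (SetoidOptionGraph.Carrier G) 0ℓ) : Set where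
  open SetoidOptionGraph G
  field
    isEquivalence : IsEquivalence ψ
    well-defined  : _≈_ ⇒ ψ
    compatible    : ∀ {p q} → ψ p q → SameClasses ψ (Opt p) (Opt q)

toSetoid : OptionGraph → SetoidOptionGraph
toSetoid D = record
  { Carrier  = Pos
  ; _≈_      = _≡_
  ; isEquiv  = Relation.Binary.PropositionalEquality.isEquivalence
  ; Opt      = Opt
  ; Opt-resp = λ { Relation.Binary.PropositionalEquality.refl →
                   (λ x s → x , s , Relation.Binary.PropositionalEquality.refl) ,
                   (λ y t → y , t , Relation.Binary.PropositionalEquality.refl) }
  ; point    = point
  }
  where open OptionGraph D

IsCongruenceOn : (D : OptionGraph) → Rel (OptionGraph.Pos D) 0ℓ → Set
IsCongruenceOn D θ = IsCongruence (toSetoid D) θ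

⋈ : (D : OptionGraph) → Rel (OptionGraph.Pos D) (lsuc 0ℓ)
⋈ D p q = Σ[ θ ∈ Rel (OptionGraph.Pos D) 0ℓ ] (IsCongruenceOn D θ × θ p q)

-- The quotient optiongraph D/θ: positions are θ-classes,
-- Opt([p]) = [Opt(p)].
Quotient : (D : OptionGraph) (θ : Rel (OptionGraph.Pos D) 0ℓ) → IsCongruenceOn D θ → SetoidOptionGraph
Quotient D θ c = record
  { Carrier  = Pos
  ; _≈_      = θ
  ; isEquiv  = IsCongruence.isEquivalence c
  ; Opt      = Opt
  ; Opt-resp = IsCongruence.compatible c
  ; point    = point
  }
  where open OptionGraph D

-- Simple: the only congruence relation is equality (of classes), i.e.
-- every congruence relation is contained in _≈_.
Simple : SetoidOptionGraph → Set₁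
Simple G = ∀ (ψ : Rel (SetoidOptionGraph.Carrier G) 0ℓ) → IsCongruence G ψ → ψ ⇒ SetoidOptionGraph._≈_ G

{-# OPTIONS --safe #-}
module Submission where

-- The congruences of D/θ are exactly the congruences of D containing θ, and
-- the equivalence closure of θ ∪ θ' is again a congruence for every
-- congruence θ'.  So D/θ is simple iff every congruence θ' satisfies θ' ⊆ θ,
-- i.e. iff θ is the largest congruence ⋈.

open import Defs
open import Level using (0ℓ)
open import Data.Product using (_×_; _,_; proj₂)
open import Data.Sum using (inj₁; inj₂; [_,_])
open import Function using (_∘_; _on_)
open import Function.Bundles using (_⇔_; mk⇔)
open import Relation.Binary.Core using (Rel; _⇒_)
open import Relation.Binary.Structures using (IsEquivalence)
open import Relation.Binary.PropositionalEquality using (refl)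
open import Relation.Binary.Construct.Union using (_∪_)
open import Relation.Binary.Construct.Closure.Equivalence as EqClosure
  using (EqClosure)
open import Relation.Binary.Construct.Closure.Symmetric using (fwd)
open import Relation.Binary.Construct.Closure.ReflexiveTransitive using (return)
import Relation.Binary.Construct.On as On

module _ {A : Set} where

  SameClasses-mono : {R T : Rel A 0ℓ} → R ⇒ T → SameClasses R ⇒ SameClasses T
  SameClasses-mono R⇒T (S⊆T , T⊆S) =
    (λ x s → let (y , t , r) = S⊆T x s in y , t , R⇒T r) ,
    (λ y t → let (x , s , r) = T⊆S y t in x , s , R⇒T r)

  SameClasses-isEquivalence : {R : Rel A 0ℓ} → IsEquivalence R →
                              IsEquivalence (SameClasses R)
  SameClasses-isEquivalence isEq = record
    { refl  = (λ x s → x , s , R-refl) , (λ y t → y , t , R-refl)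
    ; sym   = λ (S⊆T , T⊆S) →
        (λ y t → let (x , s , r) = T⊆S y t in x , s , R-sym r) ,
        (λ x s → let (y , t , r) = S⊆T x s in y , t , R-sym r)
    ; trans = λ (S⊆T , T⊆S) (T⊆U , U⊆T) →
        (λ x s → let (y , t , r) = S⊆T x s ; (z , u , r′) = T⊆U y t
                 in z , u , R-trans r r′) ,
        (λ z u → let (y , t , r) = U⊆T z u ; (x , s , r′) = T⊆S y t
                 in x , s , R-trans r′ r)
    }
    where open IsEquivalence isEq
            renaming (refl to R-refl; sym to R-sym; trans to R-trans)

Join : {A : Set} → Rel A 0ℓ → Rel A 0ℓ → Rel A 0ℓ
Join ψ₁ ψ₂ = EqClosure (ψ₁ ∪ ψ₂)

∪⇒Join : {A : Set} {ψ₁ ψ₂ : Rel A 0ℓ} → ψ₁ ∪ ψ₂ ⇒ Join ψ₁ ψ₂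
∪⇒Join = return ∘ fwd

module _ (G : SetoidOptionGraph) where
  open SetoidOptionGraph G

  Join-isCongruence : ∀ {ψ₁ ψ₂} → IsCongruence G ψ₁ → IsCongruence G ψ₂ →
                      IsCongruence G (Join ψ₁ ψ₂)
  Join-isCongruence {ψ₁} {ψ₂} c₁ c₂ = record
    { isEquivalence = EqClosure.isEquivalence (ψ₁ ∪ ψ₂)
    ; well-defined  = ∪⇒Join ∘ inj₁ ∘ IsCongruence.well-defined c₁
    ; compatible    = EqClosure.fold sameOptionClasses-isEquivalence
        [ SameClasses-mono (∪⇒Join ∘ inj₁) ∘ IsCongruence.compatible c₁
        , SameClasses-mono (∪⇒Join ∘ inj₂) ∘ IsCongruence.compatible c₂
        ]
    }
    where
    sameOptionClasses-isEquivalence :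
      IsEquivalence (SameClasses (Join ψ₁ ψ₂) on Opt)
    sameOptionClasses-isEquivalence = On.isEquivalence Opt
      (SameClasses-isEquivalence (EqClosure.isEquivalence (ψ₁ ∪ ψ₂)))

module _ (D : OptionGraph) {θ : Rel (OptionGraph.Pos D) 0ℓ}
         (c : IsCongruenceOn D θ) where

  Quotient-isCongruence⇒isCongruenceOn : ∀ {ψ} →
    IsCongruence (Quotient D θ c) ψ → IsCongruenceOn D ψ
  Quotient-isCongruence⇒isCongruenceOn cψ = record
    { isEquivalence = isEquivalence
    ; well-defined  = λ { refl → IsEquivalence.refl isEquivalence }
    ; compatible    = compatible
    }
    where open IsCongruence cψ

  isCongruenceOn⇒Quotient-isCongruence : ∀ {ψ} →
    IsCongruenceOn D ψ → θ ⇒ ψ → IsCongruence (Quotient D θ c) ψ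
  isCongruenceOn⇒Quotient-isCongruence cψ θ⇒ψ = record
    { isEquivalence = isEquivalence
    ; well-defined  = θ⇒ψ
    ; compatible    = compatible
    }
    where open IsCongruence cψ

  ⊆⋈ : θ ⇒ ⋈ D
  ⊆⋈ θpq = θ , c , θpq

  Quotient-simple⇒⋈⊆ : Simple (Quotient D θ c) → ⋈ D ⇒ θ
  Quotient-simple⇒⋈⊆ simple (θ′ , c′ , θ′pq) =
    simple (Join θ θ′) joinCongruence (∪⇒Join (inj₂ θ′pq))
    where
    joinCongruence : IsCongruence (Quotient D θ c) (Join θ θ′)
    joinCongruence = isCongruenceOn⇒Quotient-isCongruence
      (Join-isCongruence (toSetoid D) c c′)
      (∪⇒Join ∘ inj₁)

  ⋈⊆⇒Quotient-simple : ⋈ D ⇒ θ → Simple (Quotient D θ c)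
  ⋈⊆⇒Quotient-simple ⋈⊆θ ψ cψ ψpq =
    ⋈⊆θ (ψ , Quotient-isCongruence⇒isCongruenceOn cψ , ψpq)

mainTheorem11 : (D : OptionGraph) (θ : Rel (OptionGraph.Pos D) 0ℓ) (c : IsCongruenceOn D θ) →
    Simple (Quotient D θ c) ⇔ ((θ ⇒ ⋈ D) × (⋈ D ⇒ θ))
mainTheorem11 D θ c = mk⇔ to (⋈⊆⇒Quotient-simple D c ∘ proj₂)
  where
  to : Simple (Quotient D θ c) → (θ ⇒ ⋈ D) × (⋈ D ⇒ θ)
  to simple = ⊆⋈ D c , Quotient-simple⇒⋈⊆ D c simple
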